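{- Let $x_1,\dots,x_n$ be the colexicographically sorted $k$-mers of the extended $k$-spectrum of a set of strings, and let $LCS$ be its longest common suffix array. Let $\alpha\in\Sigma^*$ and $c\in\Sigma$, and suppose $[\ell,r]_{c\alpha}$ is an L-interval (i.e. $[\ell,r]$ is the colexicographic interval of $c\alpha$, it is an L-interval, and $c\alpha$ is the shortest string whose colexicographic interval is $[\ell,r]$), with $r<n$. Then $LCS[r+1]=|\alpha|$.
   Context: Strings $T_1,\dots,T_m$ are over an alphabet $\Sigma$; $\$\notin\Sigma$ is a special character smaller than every character of $\Sigma$. The colexicographic order of two strings is the lexicographic order of their reversals. The $k$-spectrum $S_k(T)$ of a string $T$ is the set of distinct length-$k$ substrings of $T$; for a set of strings it is the union. The $k$-prefix set of $T$ is $P_k(T)=\{\$^{k-i}T[1..i] : i=0,\dots,k-1\}$ (union over a set of strings). The $k$-source set of a set $K$ of $k$-mers is $R_k(K)=\{x\in K : \text{there is no } y\in K \text{ with } y[2..k]=x[1..k-1]\}$. The extended $k$-spectrum is $S'_k(T_1,\dots,T_m)=S_k(T_1,\dots,T_m)\cup P_k(R_k(S_k(T_1,\dots,T_m)))\cup\{\$^k\}$; let $n$ be its size and $x_i$ its colexicographically $i$-th element ($1\le i\le n$). The LCS array has $LCS[1]=0$ and, for $i>1$, $LCS[i]$ is the length of the longest common suffix of $x_{i-1}$ and $x_i$ (the empty string counts as a common suffix). For a string $\alpha$ that is a suffix of at least one $x_i$, its colexicographic interval $[\ell,r]_\alpha$ has $\ell$ and $r$ the colexicographic ranks of the smallest and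 largest $x_i$ having $\alpha$ as a suffix (the empty string has interval $[1,n]$). A colexicographic interval $[\ell,r]$ is an L-interval iff it is the longest (i.e. with smallest left endpoint) colexicographic interval among those of all strings whose interval has right endpoint $r$; the notation $[\ell,r]_\alpha$ for an L-interval means $\alpha$ is the shortest string whose colexicographic interval is $[\ell,r]$. -}

module Defs where

open import Level using (0ℓ)
open import Data.Nat using (ℕ; zero; suc; _≤_; _<_; _∸_)
open import Data.List using (List; []; _∷_; _++_; map; reverse; take; drop; replicate; length)
open import Data.List.Membership.Propositional using (_∈_)
open import Data.Product using (Σ; ∃; ∃-syntax; _×_; _,_)
open import Data.Sum using (_⊎_)
open import Relation.Nullary using (¬_; yes; no)
open import Relation.Binary.Core using (Rel)
open import Relation.Binary.Structures using (IsStrictTotalOrder)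
open import Relation.Binary.PropositionalEquality using (_≡_; refl)
open import Function.Bundles using (_⇔_)

-- Extended alphabet Σ ∪ {$}; `dol` is the special character $.
data XChar (A : Set) : Set where
  dol : XChar A
  ch  : A → XChar A

module Colex {A : Set} {_≺_ : Rel A 0ℓ} (sto : IsStrictTotalOrder _≡_ _≺_) where

  Word : Set
  Word = List (XChar A)

  data _<X_ : XChar A → XChar A → Set where
    $<ch  : ∀ {a} → dol <X ch a
    ch<ch : ∀ {a b} → a ≺ b → ch a <X ch b

  data _<lex_ : Word → Word → Set where
    []<∷  : ∀ {b bs} → [] <lex (b ∷ bs)
    head< : ∀ {a b as bs} → a <X b → (a ∷ as) <lex (b ∷ bs)
    tail< : ∀ {a as bs} → as <lex bs → (a ∷ as) <lex (a ∷ bs)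

  _<colex_ : Word → Word → Set
  u <colex v = reverse u <lex reverse v

  _≟X_ : (a b : XChar A) → Relation.Nullary.Dec (a ≡ b)
  dol ≟X dol = yes refl
  dol ≟X ch _ = no (λ ())
  ch _ ≟X dol = no (λ ())
  ch a ≟X ch b with IsStrictTotalOrder._≟_ sto a b
  ... | yes refl = yes refl
  ... | no a≢b = no (λ { refl → a≢b refl })

  lcp : Word → Word → ℕ
  lcp (a ∷ as) (b ∷ bs) with a ≟X b
  ... | yes _ = suc (lcp as bs)
  ... | no _ = 0
  lcp _ _ = 0

  lcs : Word → Word → ℕ
  lcs u v = lcp (reverse u) (reverse v)

  IsSubstr : ℕ → List A → Word → Set
  IsSubstr k T y = ∃[ u ] ∃[ z ] ∃[ w ] (T ≡ u ++ z ++ w × length z ≡ k × y ≡ map ch z)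

  Spec : ℕ → List (List A) → Word → Set
  Spec k Ts y = ∃[ T ] (T ∈ Ts × IsSubstr k T y)

  Source : ℕ → List (List A) → Word → Set
  Source k Ts x = Spec k Ts x × ¬ (∃[ y ] (Spec k Ts y × drop 1 y ≡ take (k ∸ 1) x))

  PrefOf : ℕ → Word → Word → Set
  PrefOf k x z = ∃[ i ] (i < k × z ≡ replicate (k ∸ i) dol ++ take i x)

  ExtSpec : ℕ → List (List A) → Word → Set
  ExtSpec k Ts z = Spec k Ts z
                 ⊎ (∃[ x ] (Source k Ts x × PrefOf k x z))
                 ⊎ z ≡ replicate k dol

  -- x : ℕ → Word lists (with 1-based ranks 1..n) the elements of S'_k(Ts)
  -- in strictly increasing colexicographic order.
  record ColexSorted (k : ℕ) (Ts : List (List A)) (n : ℕ) (x : ℕ → Word) : Set where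
    field
      increasing : ∀ i j → 1 ≤ i → i < j → j ≤ n → x i <colex x j
      enumerates : ∀ z → ExtSpec k Ts z ⇔ (∃[ i ] (1 ≤ i × i ≤ n × x i ≡ z))

  LCS : (ℕ → Word) → ℕ → ℕ
  LCS x zero = 0
  LCS x (suc zero) = 0
  LCS x (suc (suc i)) = lcs (x (suc i)) (x (suc (suc i)))

  IsSuffix : Word → Word → Set
  IsSuffix α w = ∃[ u ] (w ≡ u ++ α)

  ColexInterval : ℕ → (ℕ → Word) → Word → ℕ → ℕ → Set
  ColexInterval n x α ℓ r =
    1 ≤ ℓ × ℓ ≤ n × IsSuffix α (x ℓ) ×
    1 ≤ r × r ≤ n × IsSuffix α (x r) ×
    (∀ i → 1 ≤ i → i ≤ n → IsSuffix α (x i) → ℓ ≤ i × i ≤ r)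

  LIntervalOf : ℕ → (ℕ → Word) → Word → ℕ → ℕ → Set
  LIntervalOf n x α ℓ r =
    ColexInterval n x α ℓ r ×
    (∀ β ℓ' → ColexInterval n x β ℓ' r → ℓ ≤ ℓ') ×
    (∀ β → ColexInterval n x β ℓ r → length α ≤ length β)

{-# OPTIONS --safe #-}
-- The k-mers with a given suffix form a contiguous block of the colex order.
-- If x_{r+1} did not end with α, the block of α would end at r, and being a
-- superset of the block of cα it would start at or before ℓ; the L-interval
-- property forces it to start at ℓ, so α would be a shorter string with
-- interval [ℓ,r]. Hence x_{r+1} ends with α but not with cα, while x_r ends
-- with cα, and their longest common suffix is exactly α.
module Submission where

open import Defs
open import Level using (0ℓ)
open import Data.Nat using (ℕ; zero; suc; _<_; _≤_; z≤n; s≤s; _≤?_; _≟_)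
open import Data.Nat.Properties
  using (≤-antisym; ≰⇒>; ≮⇒≥; n<1+n; ≤∧≢⇒<; <-irrefl; anyUpTo?)
open import Data.Nat.Induction using (<-rec)
open import Data.List using (List; []; _∷_; _++_; [_]; map; length; reverse)
open import Data.List.Properties
  using (++-monoid; ++-assoc; unfold-reverse; reverse-++; reverse-involutive; length-reverse; length-map)
open import Data.List.Relation.Binary.Suffix.Heterogeneous using (Suffix)
open import Data.List.Relation.Binary.Suffix.Heterogeneous.Properties using (suffix?)
open import Data.List.Relation.Binary.Suffix.Propositional.Properties
  using (Suffix-as-∣ʳ; ∣ʳ-as-Suffix)
open import Algebra.Bundles using (Monoid)
open import Data.Product using (∃-syntax; _×_; _,_; proj₁; proj₂)
open import Data.Empty using (⊥-elim)
open import Relation.Nullary using (¬_; Dec; yes; no)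
open import Relation.Nullary.Decidable using (map′; _×-dec_)
open import Relation.Unary using (Pred; Decidable)
open import Relation.Binary.Core using (Rel)
open import Relation.Binary.Structures using (IsStrictTotalOrder)
open import Relation.Binary.PropositionalEquality
  using (_≡_; _≢_; refl; sym; trans; cong; cong₂; subst; module ≡-Reasoning)

least-witness : ∀ {p} {P : Pred ℕ p} → Decidable P → ∀ b → P b → ∃[ m ] (P m × ∀ i → P i → m ≤ i)
least-witness {P = P} P? = <-rec _ step
  where
    step : ∀ b → (∀ {i} → i < b → P i → ∃[ m ] (P m × ∀ j → P j → m ≤ j)) →
           P b → ∃[ m ] (P m × ∀ j → P j → m ≤ j)
    step b smaller Pb with anyUpTo? P? b
    ... | yes (i , i<b , Pi) = smaller i<b Pi
    ... | no none-below = b , Pb , λ j Pj → ≮⇒≥ λ j<b → none-below (j , j<b , Pj)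

reverse-∷-++ : {B : Set} (a : B) (β t : List B) → reverse (a ∷ β) ++ t ≡ reverse β ++ a ∷ t
reverse-∷-++ a β t = begin
  reverse (a ∷ β) ++ t     ≡⟨ cong (_++ t) (unfold-reverse a β) ⟩
  (reverse β ++ [ a ]) ++ t ≡⟨ ++-assoc (reverse β) [ a ] t ⟩
  reverse β ++ a ∷ t       ∎
  where open ≡-Reasoning

module _ {A : Set} {_≺_ : Rel A 0ℓ} (sto : IsStrictTotalOrder _≡_ _≺_) where
  open Colex sto
  private module STO = IsStrictTotalOrder sto

  <X-irrefl : ∀ {a} → ¬ (a <X a)
  <X-irrefl (ch<ch a≺a) = STO.irrefl refl a≺a

  <X-asym : ∀ {a b} → a <X b → ¬ (b <X a)
  <X-asym (ch<ch a≺b) (ch<ch b≺a) = STO.asym a≺b b≺a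

  <lex-prefix-convex : ∀ p {u v w} → (p ++ u) <lex w → w <lex (p ++ v) → ∃[ t ] (w ≡ p ++ t)
  <lex-prefix-convex []      _            _            = _ , refl
  <lex-prefix-convex (a ∷ p) (head< a<b)  (head< b<a)  = ⊥-elim (<X-asym a<b b<a)
  <lex-prefix-convex (a ∷ p) (head< a<a)  (tail< _)    = ⊥-elim (<X-irrefl a<a)
  <lex-prefix-convex (a ∷ p) (tail< _)    (head< a<a)  = ⊥-elim (<X-irrefl a<a)
  <lex-prefix-convex (a ∷ p) (tail< pu<w) (tail< w<pv) =
    let t , w≡pt = <lex-prefix-convex p pu<w w<pv in t , cong (a ∷_) w≡pt

  IsSuffix⇒reverse-prefix : ∀ {α w} → IsSuffix α w → ∃[ t ] (reverse w ≡ reverse α ++ t)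
  IsSuffix⇒reverse-prefix {α} (u , refl) = reverse u , reverse-++ u α

  reverse-prefix⇒IsSuffix : ∀ {α w} → ∃[ t ] (reverse w ≡ reverse α ++ t) → IsSuffix α w
  reverse-prefix⇒IsSuffix {α} {w} (t , eq) = reverse t , (begin
    w                               ≡⟨ reverse-involutive w ⟨
    reverse (reverse w)             ≡⟨ cong reverse eq ⟩
    reverse (reverse α ++ t)        ≡⟨ reverse-++ (reverse α) t ⟩
    reverse t ++ reverse (reverse α) ≡⟨ cong (reverse t ++_) (reverse-involutive α) ⟩
    reverse t ++ α                  ∎)
    where open ≡-Reasoning

  <colex-suffix-convex : ∀ {α u v w} → IsSuffix α u → IsSuffix α v →
                         u <colex w → w <colex v → IsSuffix α w
  <colex-suffix-convex {α} αu αv u<w w<v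
    with t , eu ← IsSuffix⇒reverse-prefix αu | t′ , ev ← IsSuffix⇒reverse-prefix αv =
    reverse-prefix⇒IsSuffix
      (<lex-prefix-convex (reverse α) (subst (_<lex _) eu u<w) (subst (_ <lex_) ev w<v))

  isSuffix? : ∀ α w → Dec (IsSuffix α w)
  isSuffix? α w = map′ from to (suffix? _≟X_ α w)
    where
      -- the stdlib relates Suffix to right divisibility in the (++, []) monoid, a record with constructor _,_
      open import Algebra.Definitions.RawMagma (Monoid.rawMagma (++-monoid (XChar A))) using (_,_)

      from : Suffix _≡_ α w → IsSuffix α w
      from s with q , eq ← Suffix-as-∣ʳ s = q , sym eq

      to : IsSuffix α w → Suffix _≡_ α w
      to (q , eq) = ∣ʳ-as-Suffix (q , sym eq)

  IsSuffix-tail : ∀ {a β w} → IsSuffix (a ∷ β) w → IsSuffix β w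
  IsSuffix-tail {a} {β} (u , refl) = u ++ [ a ] , sym (++-assoc u [ a ] β)

  lcp-++ : ∀ p {a s t} → (∀ t′ → t ≢ a ∷ t′) → lcp (p ++ a ∷ s) (p ++ t) ≡ length p
  lcp-++ [] {a} {t = []}    _     = refl
  lcp-++ [] {a} {t = b ∷ t} a∤t with a ≟X b
  ... | yes refl = ⊥-elim (a∤t t refl)
  ... | no _     = refl
  lcp-++ (b ∷ p) a∤t with b ≟X b
  ... | yes _ = cong suc (lcp-++ p a∤t)
  ... | no b≢b = ⊥-elim (b≢b refl)

  lcs-branch : ∀ {a β w w′} → IsSuffix (a ∷ β) w → IsSuffix β w′ → ¬ IsSuffix (a ∷ β) w′ →
               lcs w w′ ≡ length β
  lcs-branch {a} {β} (u , refl) (v , refl) aβ∤vβ = begin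
    lcp (reverse (u ++ a ∷ β)) (reverse (v ++ β))
      ≡⟨ cong₂ lcp (trans (reverse-++ u (a ∷ β)) (reverse-∷-++ a β (reverse u))) (reverse-++ v β) ⟩
    lcp (reverse β ++ a ∷ reverse u) (reverse β ++ reverse v)
      ≡⟨ lcp-++ (reverse β) a∤v ⟩
    length (reverse β)
      ≡⟨ length-reverse β ⟩
    length β
      ∎
    where
      open ≡-Reasoning
      a∤v : ∀ t → reverse v ≢ a ∷ t
      a∤v t v≡ = aβ∤vβ (reverse-prefix⇒IsSuffix (t , (begin
        reverse (v ++ β)       ≡⟨ reverse-++ v β ⟩
        reverse β ++ reverse v ≡⟨ cong (reverse β ++_) v≡ ⟩
        reverse β ++ a ∷ t     ≡⟨ reverse-∷-++ a β t ⟨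
        reverse (a ∷ β) ++ t   ∎)))

  Increasing : ℕ → (ℕ → Word) → Set
  Increasing n x = ∀ i j → 1 ≤ i → i < j → j ≤ n → x i <colex x j

  module _ {n : ℕ} {x : ℕ → Word} (increasing : Increasing n x) {β : Word} where

    suffix-block-ends : ∀ {r} → 1 ≤ r → IsSuffix β (x r) → suc r ≤ n → ¬ IsSuffix β (x (suc r)) →
                        ∀ i → 1 ≤ i → i ≤ n → IsSuffix β (x i) → i ≤ r
    suffix-block-ends {r} 1≤r βxr r<n β∤xr+1 i 1≤i i≤n βxi with i ≤? r
    ... | yes i≤r = i≤r
    ... | no i≰r with i ≟ suc r
    ...   | yes refl = ⊥-elim (β∤xr+1 βxi)
    ...   | no i≢r+1 = ⊥-elim (β∤xr+1 (<colex-suffix-convex βxr βxi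
              (increasing r (suc r) 1≤r (n<1+n r) r<n)
              (increasing (suc r) i (s≤s z≤n) (≤∧≢⇒< (≰⇒> i≰r) (λ e → i≢r+1 (sym e))) i≤n)))

    OccursAt : Pred ℕ 0ℓ
    OccursAt i = 1 ≤ i × i ≤ n × IsSuffix β (x i)

    occursAt? : Decidable OccursAt
    occursAt? i = 1 ≤? i ×-dec i ≤? n ×-dec isSuffix? β (x i)

    colexInterval-ending-at : ∀ {r} → 1 ≤ r → r ≤ n → IsSuffix β (x r) →
                              (∀ i → 1 ≤ i → i ≤ n → IsSuffix β (x i) → i ≤ r) →
                              ∃[ m ] ColexInterval n x β m r
    colexInterval-ending-at {r} 1≤r r≤n βxr ends
      with m , (1≤m , m≤n , βxm) , m-least ← least-witness occursAt? r (1≤r , r≤n , βxr) =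
      m , 1≤m , m≤n , βxm , 1≤r , r≤n , βxr ,
      λ i 1≤i i≤n βxi → m-least i (1≤i , i≤n , βxi) , ends i 1≤i i≤n βxi

    LInterval-tail-not-ending-at : ∀ {a ℓ r} → LIntervalOf n x (a ∷ β) ℓ r →
                                   ¬ (∃[ m ] ColexInterval n x β m r)
    LInterval-tail-not-ending-at {ℓ = ℓ} {r}
      ((1≤ℓ , ℓ≤n , aβxℓ , _) , L-longest , L-shortest) (m , I@(_ , _ , _ , _ , _ , _ , in-I)) =
      <-irrefl refl (L-shortest β (subst (λ m → ColexInterval n x β m r) m≡ℓ I))
      where
        m≡ℓ : m ≡ ℓ
        m≡ℓ = ≤-antisym (proj₁ (in-I ℓ 1≤ℓ ℓ≤n (IsSuffix-tail aβxℓ))) (L-longest β m I)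

    LInterval-successor-suffix : ∀ {a ℓ r} → LIntervalOf n x (a ∷ β) ℓ r → suc r ≤ n →
                                 IsSuffix β (x (suc r))
    LInterval-successor-suffix {r = r} L@((_ , _ , _ , 1≤r , r≤n , aβxr , _) , _) r<n
      with isSuffix? β (x (suc r))
    ... | yes βxr+1 = βxr+1
    ... | no β∤xr+1 = ⊥-elim (LInterval-tail-not-ending-at L
          (colexInterval-ending-at 1≤r r≤n βxr (suffix-block-ends 1≤r βxr r<n β∤xr+1)))
      where
        βxr : IsSuffix β (x r)
        βxr = IsSuffix-tail aβxr

lemma1 : {A : Set} {_≺_ : Rel A 0ℓ} (sto : IsStrictTotalOrder _≡_ _≺_)
    (k : ℕ) (Ts : List (List A)) (n : ℕ) (x : ℕ → Colex.Word sto) →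
    Colex.ColexSorted sto k Ts n x →
    (α : List A) (c : A) (ℓ r : ℕ) →
    Colex.LIntervalOf sto n x (map ch (c ∷ α)) ℓ r →
    r < n →
    Colex.LCS sto x (suc r) ≡ length α
lemma1 sto k Ts n x sorted α c ℓ zero ((_ , _ , _ , () , _) , _) r<n
lemma1 sto k Ts n x sorted α c ℓ r@(suc _) L@((_ , _ , _ , _ , _ , cαxr , in-I) , _) r<n =
  trans (lcs-branch sto cαxr αxr+1 cα∤xr+1) (length-map ch α)
  where
    open Colex sto using (IsSuffix)

    αxr+1 : IsSuffix (map ch α) (x (suc r))
    αxr+1 = LInterval-successor-suffix sto (Colex.ColexSorted.increasing sorted) L r<n

    cα∤xr+1 : ¬ IsSuffix (map ch (c ∷ α)) (x (suc r))
    cα∤xr+1 cαxr+1 = <-irrefl refl (proj₂ (in-I (suc r) (s≤s z≤n) r<n cαxr+1))
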